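{- Let $r\ge1$ be an integer and for $n\ge0$ let $\mathcal{D}_{n,r}(x)=\sum_{k=0}^n\binom nk\binom{k+r}{k}k!\,(x-1)^{n-k}$ be the $r$-derangement polynomials. Let $p\ge3$ be a prime, $s\ge1$ an integer and $m_0,\dots,m_s\in\{0,\dots,p-1\}$. Then $$\mathcal{D}_{m_0+m_1p+\cdots+m_sp^s,r}(x)\equiv\left(x^p-1\right)^{m_1}\left(x^{p^2}-1\right)^{m_2}\cdots\left(x^{p^s}-1\right)^{m_s}\mathcal{D}_{m_0,r}(x)\pmod p.$$ In particular, $$\mathcal{D}_{m_1p+\cdots+m_sp^s,r}(x)\equiv\left(x^p-1\right)^{m_1}\cdots\left(x^{p^s}-1\right)^{m_s}\pmod p,$$ and for every integer $k$, $\mathcal{D}_{m_1p+\cdots+m_sp^s,r}(k)\equiv(k-1)^{m_1+\cdots+m_s}\pmod p$.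
   Context: A congruence $P(x)\equiv Q(x)\pmod p$ between polynomials with integer coefficients means that every coefficient of $P(x)-Q(x)$ is divisible by $p$. The $r$-derangement polynomials have exponential generating function $\sum_n\mathcal{D}_{n,r}(x)\frac{t^n}{n!}=\frac{e^{ -t}}{(1-t)^{r+1}}e^{xt}$. -}

module Defs where

open import Data.Nat as ℕ using (ℕ; zero; suc)
open import Data.Nat.Combinatorics using (_C_)
open import Data.Nat using (_!)
open import Data.Integer as ℤ using (ℤ; +_; -_; 0ℤ; 1ℤ)
open import Data.Integer.Divisibility using () renaming (_∣_ to _∣ℤ_)
open import Data.List using (List; []; _∷_; replicate; _++_)
open import Data.Fin using (Fin; toℕ)
open import Data.Fin using () renaming (zero to fzero; suc to fsuc)

-- Polynomials with integer coefficients: coefficient lists, lowest degree first.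
Poly : Set
Poly = List ℤ

coeff : Poly → ℕ → ℤ
coeff []       _       = 0ℤ
coeff (a ∷ _)  zero    = a
coeff (_ ∷ as) (suc i) = coeff as i

infixl 6 _+ₚ_ _-ₚ_
infixl 7 _*ₚ_ _·ₚ_

_+ₚ_ : Poly → Poly → Poly
[]       +ₚ q        = q
(a ∷ as) +ₚ []       = a ∷ as
(a ∷ as) +ₚ (b ∷ bs) = (a ℤ.+ b) ∷ (as +ₚ bs)

_·ₚ_ : ℤ → Poly → Poly
c ·ₚ []       = []
c ·ₚ (a ∷ as) = (c ℤ.* a) ∷ (c ·ₚ as)

_-ₚ_ : Poly → Poly → Poly
p -ₚ q = p +ₚ ((- 1ℤ) ·ₚ q)

_*ₚ_ : Poly → Poly → Poly
[]       *ₚ q = []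
(a ∷ as) *ₚ q = (a ·ₚ q) +ₚ (0ℤ ∷ (as *ₚ q))

oneₚ : Poly
oneₚ = 1ℤ ∷ []

_^ₚ_ : Poly → ℕ → Poly
p ^ₚ zero  = oneₚ
p ^ₚ suc n = p *ₚ (p ^ₚ n)

xpow-1 : ℕ → Poly
xpow-1 N = (replicate N 0ℤ ++ (1ℤ ∷ [])) -ₚ oneₚ

x-1 : Poly
x-1 = (- 1ℤ) ∷ 1ℤ ∷ []

eval : Poly → ℤ → ℤ
eval []       k = 0ℤ
eval (a ∷ as) k = a ℤ.+ k ℤ.* eval as k

Σ[<_] : (n : ℕ) → (ℕ → Poly) → Poly
Σ[< zero ] f  = []
Σ[< suc n ] f = Σ[< n ] f +ₚ f n

D : ℕ → ℕ → Poly
D n r = Σ[< suc n ] (λ k → (+ ((n C k) ℕ.* ((k ℕ.+ r) C k) ℕ.* (k !))) ·ₚ (x-1 ^ₚ (n ℕ.∸ k)))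

_≡ₚ_[mod_] : Poly → Poly → ℕ → Set
P ≡ₚ Q [mod p ] = ∀ i → (+ p) ∣ℤ coeff (P -ₚ Q) i

_≡ℤ_[mod_] : ℤ → ℤ → ℕ → Set
a ≡ℤ b [mod p ] = (+ p) ∣ℤ (a ℤ.- b)

digitsVal : (p : ℕ) → {k : ℕ} → (Fin k → ℕ) → ℕ
digitsVal p {zero}  m = 0
digitsVal p {suc k} m = m fzero ℕ.+ p ℕ.* digitsVal p (λ i → m (fsuc i))

digitSum : {k : ℕ} → (Fin k → ℕ) → ℕ
digitSum {zero}  m = 0
digitSum {suc k} m = m fzero ℕ.+ digitSum (λ i → m (fsuc i))

-- Π_{i=1}^{s} (x^{p^i} - 1)^{m_i}, where m : Fin s → ℕ lists m_1, ..., m_s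
-- (the i-th entry, 0-based j, carries exponent p^(j+1))
prodFactor : (p : ℕ) → {k : ℕ} → (Fin k → ℕ) → Poly
prodFactor p = go 1
  where
  go : ℕ → {j : ℕ} → (Fin j → ℕ) → Poly
  go e {zero}  f = oneₚ
  go e {suc j} f = (xpow-1 (p ℕ.^ e) ^ₚ f fzero) *ₚ go (suc e) (λ i → f (fsuc i))

{-# OPTIONS --safe #-}
-- In characteristic p the binomial theorem gives (P + Q)^p ≡ P^p + Q^p.  For integers this is
-- Fermat's a^p ≡ a, and for polynomials it gives (x - 1)^(p^e) ≡ x^(p^e) - 1, so the product of
-- the factors (x^(p^i) - 1)^(m_i) is (x - 1)^(pN) with N = m_1 + m_2 p + ⋯ + m_s p^(s-1).
-- In D_{m+pN,r} = Σ_k C(m+pN,k) C(k+r,k) k! (x-1)^(m+pN-k) the terms with k ≥ p vanish since p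
-- divides k!, while for k < p Pascal's rule gives C(m+p,k) ≡ C(m,k); hence
-- D_{m+pN,r} ≡ (x-1)^(pN) D_{m,r}.  Evaluating at k and applying Fermat once more,
-- D_{pN,r}(k) ≡ (k-1)^(pN) ≡ (k-1)^(m_1 + ⋯ + m_s).
module Submission where

open import Defs
open import Data.Nat using (ℕ; _<_; _≥_; _*_; _+_)
open import Data.Nat.Primality using (Prime)
open import Data.Integer using (ℤ; +_; _-_; _^_)
open import Data.Fin using (Fin)
open import Data.Product using (_×_)

open import Algebra.Bundles using (CommutativeSemiring)
open import Algebra.Core using (Op₂)
open import Algebra.Definitions using (Congruent₂; Associative; LeftIdentity; Commutative)
import Algebra.Structures as Structures
import Algebra.Structures.Biased as Biased
open import Data.Fin using (toℕ; fromℕ; inject₁) renaming (zero to fzero; suc to fsuc)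
open import Data.Fin.Properties using (toℕ-fromℕ; toℕ-inject₁; toℕ<n)
open import Data.Integer using (0ℤ; 1ℤ; -1ℤ)
import Data.Integer as ℤ
import Data.Integer.DivMod as ℤ
import Data.Integer.Divisibility.Signed as ℤᵈ
import Data.Integer.Properties as ℤ
open import Data.Integer.Solver using (module +-*-Solver)
open import Data.List using ([]; _∷_)
import Data.List as List
open import Data.Nat using (zero; suc; _≤_; _!)
import Data.Nat as ℕ
open import Data.Nat.Combinatorics
  using (_C_; nCk≡n!/k![n-k]!; k![n∸k]!∣n!; nCn≡1; k>n⇒nCk≡0; nCk+nC[k+1]≡[n+1]C[k+1])
open import Data.Nat.Divisibility using (_∣_; divides; ∣-trans; ∣⇒≤; m∣m*n; n∣m*n; m≤n⇒m!∣n!)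
open import Data.Nat.DivMod using (m/n*n≡m)
open import Data.Nat.Primality using (euclidsLemma; prime⇒nonTrivial; prime⇒nonZero)
import Data.Nat.Properties as ℕ
import Data.Nat.Solver
open import Data.Product using (_,_)
open import Data.Sum using (inj₁; inj₂)
open import Data.Vec.Functional using (head; tail; init; replicate)
open import Function using (_∘_)
open import Level using (0ℓ)
open import Relation.Binary.Bundles using (Setoid)
open import Relation.Binary.Core using (Rel; _⇒_)
open import Relation.Binary.PropositionalEquality
  using (_≡_; refl; sym; trans; cong; cong₂; subst; subst₂; isEquivalence; module ≡-Reasoning)
import Relation.Binary.Reasoning.Setoid as SetoidReasoning
open import Relation.Binary.Structures using (IsEquivalence)
open import Relation.Nullary using (¬_; yes; no; contradiction)

module ℕ-Solver = Data.Nat.Solver.+-*-Solver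

prime∤! : ∀ {p} → Prime p → ∀ {k} → k < p → ¬ p ∣ k !
prime∤! {p} p-prime {zero}  k<p p∣1 = ℕ.<⇒≱ (ℕ.nonTrivial⇒n>1 p {{prime⇒nonTrivial p-prime}}) (∣⇒≤ p∣1)
prime∤! {p} p-prime {suc k} k<p p∣k! with euclidsLemma (suc k) (k !) p-prime p∣k!
... | inj₁ p∣1+k = ℕ.<⇒≱ k<p (∣⇒≤ p∣1+k)
... | inj₂ p∣k!  = prime∤! p-prime (ℕ.<-trans (ℕ.n<1+n k) k<p) p∣k!

nCk*k!*[n∸k]!≡n! : ∀ {n k} → k ≤ n → (n C k) * (k ! * (n ℕ.∸ k) !) ≡ n !
nCk*k!*[n∸k]!≡n! {n} {k} k≤n = trans (cong (_* (k ! * (n ℕ.∸ k) !)) (nCk≡n!/k![n-k]! k≤n))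
  (m/n*n≡m {{ℕ._!*_!≢0 k (n ℕ.∸ k)}} (k![n∸k]!∣n! k≤n))

n∣n! : ∀ n → .{{ℕ.NonZero n}} → n ∣ n !
n∣n! (suc n) = m∣m*n (n !)

prime∣C : ∀ {p} → Prime p → ∀ {k} → 0 < k → k < p → p ∣ p C k
prime∣C {p} p-prime {k} 0<k k<p
  with euclidsLemma (p C k) (k ! * (p ℕ.∸ k) !) p-prime
         (subst (p ∣_) (sym (nCk*k!*[n∸k]!≡n! (ℕ.<⇒≤ k<p))) (n∣n! p {{prime⇒nonZero p-prime}}))
... | inj₁ p∣C = p∣C
... | inj₂ p∣k!*[p∸k]! with euclidsLemma (k !) ((p ℕ.∸ k) !) p-prime p∣k!*[p∸k]!
...   | inj₁ p∣k!     = contradiction p∣k! (prime∤! p-prime k<p)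
...   | inj₂ p∣[p∸k]! = contradiction p∣[p∸k]! (prime∤! p-prime (ℕ.∸-monoʳ-< 0<k (ℕ.<⇒≤ k<p)))

isCommutativeSemiring-coarsen :
  ∀ {a ℓ₁ ℓ₂} {A : Set a} {_≈₁_ : Rel A ℓ₁} {_≈₂_ : Rel A ℓ₂} {_+_ _*_ : Op₂ A} {0# 1# : A} →
  Structures.IsCommutativeSemiring _≈₁_ _+_ _*_ 0# 1# →
  IsEquivalence _≈₂_ → _≈₁_ ⇒ _≈₂_ → Congruent₂ _≈₂_ _+_ → Congruent₂ _≈₂_ _*_ →
  Structures.IsCommutativeSemiring _≈₂_ _+_ _*_ 0# 1#
isCommutativeSemiring-coarsen {_≈₁_ = _≈₁_} {_≈₂_ = _≈₂_} S ≈₂-isEquivalence ≈₁⇒≈₂ +-cong₂ *-cong₂ =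
  Biased.isCommutativeSemiringˡ record
    { +-isCommutativeMonoid = commutativeMonoid +-cong₂ +-assoc +-identityˡ +-comm
    ; *-isCommutativeMonoid = commutativeMonoid *-cong₂ *-assoc *-identityˡ *-comm
    ; distribʳ              = λ x y z → ≈₁⇒≈₂ (distribʳ x y z)
    ; zeroˡ                 = λ x → ≈₁⇒≈₂ (zeroˡ x)
    }
  where
    open Structures.IsCommutativeSemiring S
      using (+-assoc; +-identityˡ; +-comm; *-assoc; *-identityˡ; *-comm; distribʳ; zeroˡ)
    commutativeMonoid : ∀ {_∙_ ε} → Congruent₂ _≈₂_ _∙_ → Associative _≈₁_ _∙_ → LeftIdentity _≈₁_ ε _∙_ →
                        Commutative _≈₁_ _∙_ → Structures.IsCommutativeMonoid _≈₂_ _∙_ ε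
    commutativeMonoid ∙-cong assoc identityˡ comm = Biased.isCommutativeMonoidˡ record
      { isSemigroup = record
        { isMagma = record { isEquivalence = ≈₂-isEquivalence ; ∙-cong = ∙-cong }
        ; assoc   = λ x y z → ≈₁⇒≈₂ (assoc x y z)
        }
      ; identityˡ = λ x → ≈₁⇒≈₂ (identityˡ x)
      ; comm      = λ x y → ≈₁⇒≈₂ (comm x y)
      }

module Frobenius {c ℓ} (R : CommutativeSemiring c ℓ) where

  open CommutativeSemiring R
    using ( Carrier; _≈_; 0#; 1#; setoid; semiring; +-cong; +-congˡ; +-congʳ
          ; +-identityˡ; +-identityʳ; +-comm; *-identityˡ; *-identityʳ)
    renaming (_+_ to _+ᴿ_; _*_ to _*ᴿ_; trans to ≈-trans)
  open import Algebra.Properties.Semiring.Mult semiring using (×-assocˡ; ×-congˡ) renaming (_×_ to _×ᴿ_)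
  open import Algebra.Properties.Semiring.Exp semiring using () renaming (_^_ to _^ᴿ_)
  open import Algebra.Properties.Semiring.Sum semiring using (sum; sum-cong-≋; sum-init-last; sum-replicate-zero)
  open import Algebra.Properties.CommutativeSemiring.Binomial R using (theorem; binomialTerm)
  open SetoidReasoning setoid

  ×-vanishes : ∀ {p m} → (∀ z → p ×ᴿ z ≈ 0#) → p ∣ m → ∀ z → m ×ᴿ z ≈ 0#
  ×-vanishes {p} char (divides q refl) z = begin
    (q * p) ×ᴿ z    ≡⟨ cong (_×ᴿ z) (ℕ.*-comm q p) ⟩
    (p * q) ×ᴿ z    ≈⟨ ×-assocˡ z p q ⟨
    p ×ᴿ (q ×ᴿ z)   ≈⟨ char (q ×ᴿ z) ⟩
    0#              ∎

  frobenius : ∀ {p} → Prime p → (∀ z → p ×ᴿ z ≈ 0#) → ∀ x y → (x +ᴿ y) ^ᴿ p ≈ x ^ᴿ p +ᴿ y ^ᴿ p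
  frobenius {zero}  p-prime = contradiction refl (ℕ.≢-nonZero⁻¹ 0 {{prime⇒nonZero p-prime}})
  frobenius {suc n} p-prime char x y = begin
    (x +ᴿ y) ^ᴿ p                                          ≈⟨ theorem p x y ⟩
    term fzero +ᴿ sum (tail term)                          ≈⟨ +-cong first (sum-init-last (tail term)) ⟩
    y ^ᴿ p +ᴿ (sum (init (tail term)) +ᴿ term (fromℕ p))   ≈⟨ +-congˡ (+-cong (sum-cong-≋ middle) last) ⟩
    y ^ᴿ p +ᴿ (sum (replicate n 0#) +ᴿ x ^ᴿ p)             ≈⟨ +-congˡ (+-congʳ (sum-replicate-zero n)) ⟩
    y ^ᴿ p +ᴿ (0# +ᴿ x ^ᴿ p)                               ≈⟨ +-congˡ (+-identityˡ (x ^ᴿ p)) ⟩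
    y ^ᴿ p +ᴿ x ^ᴿ p                                       ≈⟨ +-comm (y ^ᴿ p) (x ^ᴿ p) ⟩
    x ^ᴿ p +ᴿ y ^ᴿ p                                       ∎
    where
      p : ℕ
      p = suc n
      term : Fin (suc p) → Carrier
      term = binomialTerm x y p
      first : term fzero ≈ y ^ᴿ p
      first = ≈-trans (+-identityʳ _) (*-identityˡ _)
      middle : ∀ i → term (fsuc (inject₁ i)) ≈ 0#
      middle i = ×-vanishes char
        (prime∣C p-prime ℕ.z<s (ℕ.s<s (subst (_< n) (sym (toℕ-inject₁ i)) (toℕ<n i)))) _
      T : ℕ → Carrier
      T j = (p C j) ×ᴿ (x ^ᴿ j *ᴿ y ^ᴿ (p ℕ.∸ j))
      last : term (fromℕ p) ≈ x ^ᴿ p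
      last = begin
        T (toℕ (fromℕ p))                       ≡⟨ cong T (toℕ-fromℕ p) ⟩
        (p C p) ×ᴿ (x ^ᴿ p *ᴿ y ^ᴿ (p ℕ.∸ p))   ≈⟨ ×-congˡ (nCn≡1 p) ⟩
        1 ×ᴿ (x ^ᴿ p *ᴿ y ^ᴿ (p ℕ.∸ p))         ≈⟨ +-identityʳ _ ⟩
        x ^ᴿ p *ᴿ y ^ᴿ (p ℕ.∸ p)                ≡⟨ cong (λ j → x ^ᴿ p *ᴿ y ^ᴿ j) (ℕ.n∸n≡0 p) ⟩
        x ^ᴿ p *ᴿ 1#                            ≈⟨ *-identityʳ _ ⟩
        x ^ᴿ p                                  ∎

coeff-+ : ∀ P Q i → coeff (P +ₚ Q) i ≡ coeff P i ℤ.+ coeff Q i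
coeff-+ []       Q        i       = sym (ℤ.+-identityˡ _)
coeff-+ (a ∷ as) []       zero    = sym (ℤ.+-identityʳ a)
coeff-+ (a ∷ as) []       (suc i) = sym (ℤ.+-identityʳ _)
coeff-+ (a ∷ as) (b ∷ bs) zero    = refl
coeff-+ (a ∷ as) (b ∷ bs) (suc i) = coeff-+ as bs i

coeff-· : ∀ c P i → coeff (c ·ₚ P) i ≡ c ℤ.* coeff P i
coeff-· c []       i       = sym (ℤ.*-zeroʳ c)
coeff-· c (a ∷ as) zero    = refl
coeff-· c (a ∷ as) (suc i) = coeff-· c as i

coeff-sub : ∀ P Q i → coeff (P -ₚ Q) i ≡ coeff P i - coeff Q i
coeff-sub P Q i = trans (coeff-+ P (-1ℤ ·ₚ Q) i)
  (cong (λ t → coeff P i ℤ.+ t) (trans (coeff-· -1ℤ Q i) (ℤ.-1*i≡-i (coeff Q i))))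

-- (f ⋆ g) i = Σ_{j ≤ i} f j * g (i ∸ j), the coefficient sequence of a product.
infixl 7 _⋆_
_⋆_ : (ℕ → ℤ) → (ℕ → ℤ) → ℕ → ℤ
(f ⋆ g) zero    = f 0 ℤ.* g 0
(f ⋆ g) (suc i) = f 0 ℤ.* g (suc i) ℤ.+ ((f ∘ suc) ⋆ g) i

⋆-zeroˡ : ∀ g i → ((λ _ → 0ℤ) ⋆ g) i ≡ 0ℤ
⋆-zeroˡ g zero    = refl
⋆-zeroˡ g (suc i) = trans (ℤ.+-identityˡ _) (⋆-zeroˡ g i)

coeff-* : ∀ P Q i → coeff (P *ₚ Q) i ≡ (coeff P ⋆ coeff Q) i
coeff-* []       Q i       = sym (⋆-zeroˡ (coeff Q) i)
coeff-* (a ∷ as) Q zero    =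
  trans (coeff-+ (a ·ₚ Q) (0ℤ ∷ (as *ₚ Q)) 0) (trans (ℤ.+-identityʳ _) (coeff-· a Q 0))
coeff-* (a ∷ as) Q (suc i) =
  trans (coeff-+ (a ·ₚ Q) (0ℤ ∷ (as *ₚ Q)) (suc i)) (cong₂ ℤ._+_ (coeff-· a Q (suc i)) (coeff-* as Q i))

module Coefficientwise {ℓ} {_~_ : Rel ℤ ℓ} (~-isEquivalence : IsEquivalence _~_)
               (+-cong : Congruent₂ _~_ ℤ._+_) (*-cong : Congruent₂ _~_ ℤ._*_) where

  open IsEquivalence ~-isEquivalence
    renaming (refl to ~-refl; sym to ~-sym; trans to ~-trans; reflexive to ~-reflexive)

  infix 4 _≈ₚ_
  record _≈ₚ_ (P Q : Poly) : Set ℓ where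
    constructor coeffwise
    field coeff-≈ : ∀ i → coeff P i ~ coeff Q i
  open _≈ₚ_ public

  ≈ₚ-isEquivalence : IsEquivalence _≈ₚ_
  ≈ₚ-isEquivalence = record
    { refl  = coeffwise λ _ → ~-refl
    ; sym   = λ P≈Q → coeffwise λ i → ~-sym (coeff-≈ P≈Q i)
    ; trans = λ P≈Q Q≈R → coeffwise λ i → ~-trans (coeff-≈ P≈Q i) (coeff-≈ Q≈R i)
    }

  ≈ₚ-setoid : Setoid 0ℓ ℓ
  ≈ₚ-setoid = record { isEquivalence = ≈ₚ-isEquivalence }

  open Setoid ≈ₚ-setoid public using () renaming (refl to ≈ₚ-refl; sym to ≈ₚ-sym; trans to ≈ₚ-trans)

  ≈ₚ-reflexive : ∀ {P Q} → (∀ i → coeff P i ≡ coeff Q i) → P ≈ₚ Q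
  ≈ₚ-reflexive P≡Q = coeffwise λ i → ~-reflexive (P≡Q i)

  ∷-cong : ∀ {a b P Q} → a ~ b → P ≈ₚ Q → a ∷ P ≈ₚ b ∷ Q
  ∷-cong a~b P≈Q = coeffwise λ { zero → a~b ; (suc i) → coeff-≈ P≈Q i }

  +ₚ-cong : Congruent₂ _≈ₚ_ _+ₚ_
  +ₚ-cong {P} {P′} {Q} {Q′} P≈P′ Q≈Q′ = coeffwise λ i →
    subst₂ _~_ (sym (coeff-+ P Q i)) (sym (coeff-+ P′ Q′ i)) (+-cong (coeff-≈ P≈P′ i) (coeff-≈ Q≈Q′ i))

  ·ₚ-cong : ∀ {a b P Q} → a ~ b → P ≈ₚ Q → a ·ₚ P ≈ₚ b ·ₚ Q
  ·ₚ-cong {a} {b} {P} {Q} a~b P≈Q = coeffwise λ i →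
    subst₂ _~_ (sym (coeff-· a P i)) (sym (coeff-· b Q i)) (*-cong a~b (coeff-≈ P≈Q i))

  ⋆-cong : ∀ {f f′ g g′} → (∀ j → f j ~ f′ j) → (∀ j → g j ~ g′ j) → ∀ i → (f ⋆ g) i ~ (f′ ⋆ g′) i
  ⋆-cong f~f′ g~g′ zero    = *-cong (f~f′ 0) (g~g′ 0)
  ⋆-cong f~f′ g~g′ (suc i) = +-cong (*-cong (f~f′ 0) (g~g′ (suc i))) (⋆-cong (f~f′ ∘ suc) g~g′ i)

  *ₚ-cong : Congruent₂ _≈ₚ_ _*ₚ_
  *ₚ-cong {P} {P′} {Q} {Q′} P≈P′ Q≈Q′ = coeffwise λ i →
    subst₂ _~_ (sym (coeff-* P Q i)) (sym (coeff-* P′ Q′ i)) (⋆-cong (coeff-≈ P≈P′) (coeff-≈ Q≈Q′) i)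

  +ₚ-identityʳ : ∀ P → P +ₚ [] ≈ₚ P
  +ₚ-identityʳ P = ≈ₚ-reflexive λ i → trans (coeff-+ P [] i) (ℤ.+-identityʳ _)

  eval-≈[] : ∀ {P} k → P ≈ₚ [] → eval P k ~ 0ℤ
  eval-≈[] {[]}     k P≈[] = ~-refl
  eval-≈[] {a ∷ as} k P≈[] = ~-trans
    (+-cong (coeff-≈ P≈[] 0) (*-cong (~-refl {k}) (eval-≈[] {as} k (coeffwise (coeff-≈ P≈[] ∘ suc)))))
    (~-reflexive (trans (ℤ.+-identityˡ _) (ℤ.*-zeroʳ k)))

  eval-cong : ∀ {P Q} k → P ≈ₚ Q → eval P k ~ eval Q k
  eval-cong {[]}     {[]}     k P≈Q = ~-refl
  eval-cong {[]}     {b ∷ bs} k P≈Q = ~-sym (eval-≈[] k (≈ₚ-sym P≈Q))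
  eval-cong {a ∷ as} {[]}     k P≈Q = eval-≈[] k P≈Q
  eval-cong {a ∷ as} {b ∷ bs} k P≈Q =
    +-cong (coeff-≈ P≈Q 0) (*-cong (~-refl {k}) (eval-cong {as} {bs} k (coeffwise (coeff-≈ P≈Q ∘ suc))))

  Σ-cong : ∀ n {f g} → (∀ k → k < n → f k ≈ₚ g k) → Σ[< n ] f ≈ₚ Σ[< n ] g
  Σ-cong zero    f≈g = ≈ₚ-refl
  Σ-cong (suc n) f≈g = +ₚ-cong (Σ-cong n (λ k k<n → f≈g k (ℕ.m<n⇒m<1+n k<n))) (f≈g n ℕ.≤-refl)

  Σ-vanishing-tail : ∀ m d {f} → (∀ k → m ≤ k → f k ≈ₚ []) → Σ[< m + d ] f ≈ₚ Σ[< m ] f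
  Σ-vanishing-tail m zero    {f} f≈[] rewrite ℕ.+-identityʳ m = ≈ₚ-refl
  Σ-vanishing-tail m (suc d) {f} f≈[] rewrite ℕ.+-suc m d =
    ≈ₚ-trans (+ₚ-cong (Σ-vanishing-tail m d f≈[]) (f≈[] (m + d) (ℕ.m≤m+n m d))) (+ₚ-identityʳ (Σ[< m ] f))

module Exact = Coefficientwise {_~_ = _≡_} isEquivalence (cong₂ ℤ._+_) (cong₂ ℤ._*_)
open Exact using () renaming (_≈ₚ_ to _≗ₚ_; coeffwise to coeffwise-≡; coeff-≈ to coeff-≡)

⋆-distribʳ : ∀ f f′ g i → ((λ j → f j ℤ.+ f′ j) ⋆ g) i ≡ (f ⋆ g) i ℤ.+ (f′ ⋆ g) i
⋆-distribʳ f f′ g zero    = ℤ.*-distribʳ-+ (g 0) (f 0) (f′ 0)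
⋆-distribʳ f f′ g (suc i) = begin
  (f 0 ℤ.+ f′ 0) ℤ.* g (suc i) ℤ.+ ((λ j → f (suc j) ℤ.+ f′ (suc j)) ⋆ g) i
    ≡⟨ cong (λ t → (f 0 ℤ.+ f′ 0) ℤ.* g (suc i) ℤ.+ t) (⋆-distribʳ (f ∘ suc) (f′ ∘ suc) g i) ⟩
  (f 0 ℤ.+ f′ 0) ℤ.* g (suc i) ℤ.+ (((f ∘ suc) ⋆ g) i ℤ.+ ((f′ ∘ suc) ⋆ g) i)
    ≡⟨ solve 5 (λ a b c x y → (a :+ b) :* c :+ (x :+ y) := (a :* c :+ x) :+ (b :* c :+ y)) refl
         (f 0) (f′ 0) (g (suc i)) (((f ∘ suc) ⋆ g) i) (((f′ ∘ suc) ⋆ g) i) ⟩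
  (f ⋆ g) (suc i) ℤ.+ (f′ ⋆ g) (suc i) ∎
  where
    open ≡-Reasoning
    open +-*-Solver

⋆-*ˡ : ∀ c f g i → ((λ j → c ℤ.* f j) ⋆ g) i ≡ c ℤ.* (f ⋆ g) i
⋆-*ˡ c f g zero    = ℤ.*-assoc c (f 0) (g 0)
⋆-*ˡ c f g (suc i) = begin
  c ℤ.* f 0 ℤ.* g (suc i) ℤ.+ ((λ j → c ℤ.* f (suc j)) ⋆ g) i
    ≡⟨ cong (λ t → c ℤ.* f 0 ℤ.* g (suc i) ℤ.+ t) (⋆-*ˡ c (f ∘ suc) g i) ⟩
  c ℤ.* f 0 ℤ.* g (suc i) ℤ.+ c ℤ.* ((f ∘ suc) ⋆ g) i
    ≡⟨ solve 4 (λ c a b x → c :* a :* b :+ c :* x := c :* (a :* b :+ x)) refl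
         c (f 0) (g (suc i)) (((f ∘ suc) ⋆ g) i) ⟩
  c ℤ.* (f ⋆ g) (suc i) ∎
  where
    open ≡-Reasoning
    open +-*-Solver

+ₚ-comm : ∀ P Q → P +ₚ Q ≗ₚ Q +ₚ P
+ₚ-comm P Q = coeffwise-≡ λ i → begin
  coeff (P +ₚ Q) i         ≡⟨ coeff-+ P Q i ⟩
  coeff P i ℤ.+ coeff Q i  ≡⟨ ℤ.+-comm (coeff P i) (coeff Q i) ⟩
  coeff Q i ℤ.+ coeff P i  ≡⟨ coeff-+ Q P i ⟨
  coeff (Q +ₚ P) i         ∎
  where
    open ≡-Reasoning

+ₚ-assoc : ∀ P Q R → (P +ₚ Q) +ₚ R ≗ₚ P +ₚ (Q +ₚ R)
+ₚ-assoc P Q R = coeffwise-≡ λ i → begin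
  coeff ((P +ₚ Q) +ₚ R) i                      ≡⟨ coeff-+ (P +ₚ Q) R i ⟩
  coeff (P +ₚ Q) i ℤ.+ coeff R i               ≡⟨ cong (ℤ._+ coeff R i) (coeff-+ P Q i) ⟩
  coeff P i ℤ.+ coeff Q i ℤ.+ coeff R i        ≡⟨ ℤ.+-assoc (coeff P i) (coeff Q i) (coeff R i) ⟩
  coeff P i ℤ.+ (coeff Q i ℤ.+ coeff R i)      ≡⟨ cong (λ t → coeff P i ℤ.+ t) (coeff-+ Q R i) ⟨
  coeff P i ℤ.+ coeff (Q +ₚ R) i               ≡⟨ coeff-+ P (Q +ₚ R) i ⟨
  coeff (P +ₚ (Q +ₚ R)) i                      ∎
  where
    open ≡-Reasoning

*ₚ-identityˡ : ∀ P → oneₚ *ₚ P ≗ₚ P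
*ₚ-identityˡ P = coeffwise-≡ λ i → trans (coeff-* oneₚ P i) (one⋆ i)
  where
    one⋆ : ∀ i → (coeff oneₚ ⋆ coeff P) i ≡ coeff P i
    one⋆ zero    = ℤ.*-identityˡ (coeff P 0)
    one⋆ (suc i) = trans (cong (λ t → 1ℤ ℤ.* coeff P (suc i) ℤ.+ t) (⋆-zeroˡ (coeff P) i))
                         (trans (ℤ.+-identityʳ _) (ℤ.*-identityˡ _))

*ₚ-zeroʳ : ∀ P → P *ₚ [] ≗ₚ []
*ₚ-zeroʳ []       = coeffwise-≡ λ _ → refl
*ₚ-zeroʳ (a ∷ as) = coeffwise-≡ λ { zero → refl ; (suc i) → coeff-≡ (*ₚ-zeroʳ as) i }

*ₚ-distribʳ : ∀ R P Q → (P +ₚ Q) *ₚ R ≗ₚ P *ₚ R +ₚ Q *ₚ R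
*ₚ-distribʳ R P Q = coeffwise-≡ λ i → begin
  coeff ((P +ₚ Q) *ₚ R) i                          ≡⟨ coeff-* (P +ₚ Q) R i ⟩
  (coeff (P +ₚ Q) ⋆ coeff R) i                     ≡⟨ Exact.⋆-cong (coeff-+ P Q) (λ _ → refl) i ⟩
  ((λ j → coeff P j ℤ.+ coeff Q j) ⋆ coeff R) i    ≡⟨ ⋆-distribʳ (coeff P) (coeff Q) (coeff R) i ⟩
  (coeff P ⋆ coeff R) i ℤ.+ (coeff Q ⋆ coeff R) i  ≡⟨ cong₂ ℤ._+_ (coeff-* P R i) (coeff-* Q R i) ⟨
  coeff (P *ₚ R) i ℤ.+ coeff (Q *ₚ R) i            ≡⟨ coeff-+ (P *ₚ R) (Q *ₚ R) i ⟨
  coeff (P *ₚ R +ₚ Q *ₚ R) i                       ∎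
  where
    open ≡-Reasoning

·ₚ-*ₚ-assoc : ∀ c P R → (c ·ₚ P) *ₚ R ≗ₚ c ·ₚ (P *ₚ R)
·ₚ-*ₚ-assoc c P R = coeffwise-≡ λ i → begin
  coeff ((c ·ₚ P) *ₚ R) i                  ≡⟨ coeff-* (c ·ₚ P) R i ⟩
  (coeff (c ·ₚ P) ⋆ coeff R) i             ≡⟨ Exact.⋆-cong (coeff-· c P) (λ _ → refl) i ⟩
  ((λ j → c ℤ.* coeff P j) ⋆ coeff R) i    ≡⟨ ⋆-*ˡ c (coeff P) (coeff R) i ⟩
  c ℤ.* (coeff P ⋆ coeff R) i              ≡⟨ cong (c ℤ.*_) (coeff-* P R i) ⟨
  c ℤ.* coeff (P *ₚ R) i                   ≡⟨ coeff-· c (P *ₚ R) i ⟨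
  coeff (c ·ₚ (P *ₚ R)) i                  ∎
  where
    open ≡-Reasoning

0∷-*ₚ : ∀ P R → (0ℤ ∷ P) *ₚ R ≗ₚ 0ℤ ∷ (P *ₚ R)
0∷-*ₚ P R = coeffwise-≡ λ i → begin
  coeff (0ℤ ·ₚ R +ₚ (0ℤ ∷ P *ₚ R)) i              ≡⟨ coeff-+ (0ℤ ·ₚ R) (0ℤ ∷ (P *ₚ R)) i ⟩
  coeff (0ℤ ·ₚ R) i ℤ.+ coeff (0ℤ ∷ P *ₚ R) i    ≡⟨ cong (ℤ._+ coeff (0ℤ ∷ P *ₚ R) i) (coeff-· 0ℤ R i) ⟩
  0ℤ ℤ.* coeff R i ℤ.+ coeff (0ℤ ∷ P *ₚ R) i     ≡⟨ ℤ.+-identityˡ _ ⟩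
  coeff (0ℤ ∷ P *ₚ R) i                          ∎
  where
    open ≡-Reasoning

module ≗ₚ-Reasoning = SetoidReasoning Exact.≈ₚ-setoid

*ₚ-assoc : ∀ P Q R → (P *ₚ Q) *ₚ R ≗ₚ P *ₚ (Q *ₚ R)
*ₚ-assoc []       Q R = Exact.≈ₚ-refl
*ₚ-assoc (a ∷ as) Q R = begin
  (a ·ₚ Q +ₚ (0ℤ ∷ as *ₚ Q)) *ₚ R            ≈⟨ *ₚ-distribʳ R (a ·ₚ Q) (0ℤ ∷ as *ₚ Q) ⟩
  (a ·ₚ Q) *ₚ R +ₚ (0ℤ ∷ as *ₚ Q) *ₚ R       ≈⟨ Exact.+ₚ-cong (·ₚ-*ₚ-assoc a Q R) (0∷-*ₚ (as *ₚ Q) R) ⟩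
  a ·ₚ (Q *ₚ R) +ₚ (0ℤ ∷ (as *ₚ Q) *ₚ R)     ≈⟨ Exact.+ₚ-cong Exact.≈ₚ-refl (Exact.∷-cong refl (*ₚ-assoc as Q R)) ⟩
  a ·ₚ (Q *ₚ R) +ₚ (0ℤ ∷ as *ₚ (Q *ₚ R))     ∎
  where
    open ≗ₚ-Reasoning

*ₚ-∷ʳ : ∀ P a as → P *ₚ (a ∷ as) ≗ₚ a ·ₚ P +ₚ (0ℤ ∷ P *ₚ as)
*ₚ-∷ʳ []       a as = coeffwise-≡ λ { zero → refl ; (suc i) → refl }
*ₚ-∷ʳ (b ∷ bs) a as = Exact.∷-cong (cong (ℤ._+ 0ℤ) (ℤ.*-comm b a)) (begin
  b ·ₚ as +ₚ bs *ₚ (a ∷ as)                 ≈⟨ Exact.+ₚ-cong Exact.≈ₚ-refl (*ₚ-∷ʳ bs a as) ⟩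
  b ·ₚ as +ₚ (a ·ₚ bs +ₚ (0ℤ ∷ bs *ₚ as))   ≈⟨ Exact.≈ₚ-sym (+ₚ-assoc (b ·ₚ as) (a ·ₚ bs) _) ⟩
  (b ·ₚ as +ₚ a ·ₚ bs) +ₚ (0ℤ ∷ bs *ₚ as)   ≈⟨ Exact.+ₚ-cong (+ₚ-comm (b ·ₚ as) (a ·ₚ bs)) Exact.≈ₚ-refl ⟩
  (a ·ₚ bs +ₚ b ·ₚ as) +ₚ (0ℤ ∷ bs *ₚ as)   ≈⟨ +ₚ-assoc (a ·ₚ bs) (b ·ₚ as) _ ⟩
  a ·ₚ bs +ₚ (b ·ₚ as +ₚ (0ℤ ∷ bs *ₚ as))   ∎)
  where
    open ≗ₚ-Reasoning

*ₚ-comm : ∀ P Q → P *ₚ Q ≗ₚ Q *ₚ P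
*ₚ-comm []       Q = Exact.≈ₚ-sym (*ₚ-zeroʳ Q)
*ₚ-comm (a ∷ as) Q = Exact.≈ₚ-trans
  (Exact.+ₚ-cong (Exact.≈ₚ-refl {a ·ₚ Q}) (Exact.∷-cong refl (*ₚ-comm as Q))) (Exact.≈ₚ-sym (*ₚ-∷ʳ Q a as))

Poly-isCommutativeSemiring : Structures.IsCommutativeSemiring _≗ₚ_ _+ₚ_ _*ₚ_ [] oneₚ
Poly-isCommutativeSemiring = Biased.isCommutativeSemiringˡ record
  { +-isCommutativeMonoid = Biased.isCommutativeMonoidˡ record
    { isSemigroup = record
      { isMagma = record { isEquivalence = Exact.≈ₚ-isEquivalence ; ∙-cong = Exact.+ₚ-cong }
      ; assoc   = +ₚ-assoc
      }
    ; identityˡ = λ _ → Exact.≈ₚ-refl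
    ; comm      = +ₚ-comm
    }
  ; *-isCommutativeMonoid = Biased.isCommutativeMonoidˡ record
    { isSemigroup = record
      { isMagma = record { isEquivalence = Exact.≈ₚ-isEquivalence ; ∙-cong = Exact.*ₚ-cong }
      ; assoc   = *ₚ-assoc
      }
    ; identityˡ = *ₚ-identityˡ
    ; comm      = *ₚ-comm
    }
  ; distribʳ = *ₚ-distribʳ
  ; zeroˡ    = λ _ → Exact.≈ₚ-refl
  }

·ₚ-zeroˡ : ∀ P → 0ℤ ·ₚ P ≗ₚ []
·ₚ-zeroˡ P = coeffwise-≡ (coeff-· 0ℤ P)

Σ-*ₚ-distribʳ : ∀ n f X → Σ[< n ] (λ k → f k *ₚ X) ≗ₚ Σ[< n ] f *ₚ X
Σ-*ₚ-distribʳ zero    f X = Exact.≈ₚ-refl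
Σ-*ₚ-distribʳ (suc n) f X = Exact.≈ₚ-trans
  (Exact.+ₚ-cong (Σ-*ₚ-distribʳ n f X) (Exact.≈ₚ-refl {f n *ₚ X}))
  (Exact.≈ₚ-sym (*ₚ-distribʳ X (Σ[< n ] f) (f n)))

monomial : ℕ → Poly
monomial N = List.replicate N 0ℤ List.++ (1ℤ ∷ [])

monomial-* : ∀ a b → monomial a *ₚ monomial b ≗ₚ monomial (a + b)
monomial-* zero    b = *ₚ-identityˡ (monomial b)
monomial-* (suc a) b = Exact.≈ₚ-trans (0∷-*ₚ (monomial a) (monomial b)) (Exact.∷-cong refl (monomial-* a b))

monomial-^ : ∀ a n → monomial a ^ₚ n ≗ₚ monomial (a * n)
monomial-^ a zero    rewrite ℕ.*-zeroʳ a = Exact.≈ₚ-refl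
monomial-^ a (suc n) rewrite ℕ.*-suc a n =
  Exact.≈ₚ-trans (Exact.*ₚ-cong (Exact.≈ₚ-refl {monomial a}) (monomial-^ a n)) (monomial-* a (a * n))

constant-^ : ∀ c n → (c ∷ []) ^ₚ n ≗ₚ (c ^ n ∷ [])
constant-^ c zero    = Exact.≈ₚ-refl
constant-^ c (suc n) = Exact.≈ₚ-trans (Exact.*ₚ-cong (Exact.≈ₚ-refl {c ∷ []}) (constant-^ c n))
  (coeffwise-≡ λ { zero → ℤ.+-identityʳ _ ; (suc i) → refl })

eval-+ : ∀ P Q k → eval (P +ₚ Q) k ≡ eval P k ℤ.+ eval Q k
eval-+ []       Q        k = sym (ℤ.+-identityˡ _)
eval-+ (a ∷ as) []       k = sym (ℤ.+-identityʳ _)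
eval-+ (a ∷ as) (b ∷ bs) k rewrite eval-+ as bs k =
  solve 5 (λ a b k x y → a :+ b :+ k :* (x :+ y) := a :+ k :* x :+ (b :+ k :* y)) refl
    a b k (eval as k) (eval bs k)
  where
    open +-*-Solver

eval-· : ∀ c P k → eval (c ·ₚ P) k ≡ c ℤ.* eval P k
eval-· c []       k = sym (ℤ.*-zeroʳ c)
eval-· c (a ∷ as) k rewrite eval-· c as k =
  solve 4 (λ c a k x → c :* a :+ k :* (c :* x) := c :* (a :+ k :* x)) refl c a k (eval as k)
  where
    open +-*-Solver

eval-* : ∀ P Q k → eval (P *ₚ Q) k ≡ eval P k ℤ.* eval Q k
eval-* []       Q k = refl
eval-* (a ∷ as) Q k rewrite eval-+ (a ·ₚ Q) (0ℤ ∷ as *ₚ Q) k | eval-· a Q k | eval-* as Q k =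
  solve 4 (λ a q k x → a :* q :+ (con 0ℤ :+ k :* (x :* q)) := (a :+ k :* x) :* q) refl
    a (eval Q k) k (eval as k)
  where
    open +-*-Solver

eval-x-1^ : ∀ n k → eval (x-1 ^ₚ n) k ≡ (k - 1ℤ) ^ n
eval-x-1^ zero    k = cong (λ t → 1ℤ ℤ.+ t) (ℤ.*-zeroʳ k)
eval-x-1^ (suc n) k = trans (eval-* x-1 (x-1 ^ₚ n) k) (cong₂ ℤ._*_ x-1-at-k (eval-x-1^ n k))
  where
    x-1-at-k : eval x-1 k ≡ k - 1ℤ
    x-1-at-k = solve 1 (λ k → con -1ℤ :+ k :* (con 1ℤ :+ k :* con 0ℤ) := k :- con 1ℤ) refl k
      where
        open +-*-Solver

factorsFrom : ℕ → ℕ → {j : ℕ} → (Fin j → ℕ) → Poly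
factorsFrom p e {zero}  m = oneₚ
factorsFrom p e {suc j} m = xpow-1 (p ℕ.^ e) ^ₚ head m *ₚ factorsFrom p (suc e) (tail m)

factorsFrom-unique : ∀ p (G : ℕ → {j : ℕ} → (Fin j → ℕ) → Poly) →
  (∀ e m → G e {0} m ≡ oneₚ) →
  (∀ e {j} m → G e {suc j} m ≡ xpow-1 (p ℕ.^ e) ^ₚ head m *ₚ G (suc e) (tail m)) →
  ∀ e {j} (m : Fin j → ℕ) → G e m ≡ factorsFrom p e m
factorsFrom-unique p G G-[] G-∷ e {zero}  m = G-[] e m
factorsFrom-unique p G G-[] G-∷ e {suc j} m =
  trans (G-∷ e m) (cong (xpow-1 (p ℕ.^ e) ^ₚ head m *ₚ_) (factorsFrom-unique p G G-[] G-∷ (suc e) (tail m)))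

-- The local helper of prodFactor cannot be named here; abstracting the literal 1 lets unification
-- instantiate go with it.
prodFactor≡factorsFrom : ∀ p {j} (m : Fin j → ℕ) → prodFactor p m ≡ factorsFrom p 1 m
prodFactor≡factorsFrom p m = trans (unfold m) (factorsFrom-unique p go (λ _ _ → refl) (λ _ _ → refl) 1 m)
  where
    go : ℕ → {j : ℕ} → (Fin j → ℕ) → Poly
    go = _
    unfold : ∀ {j} (m : Fin j → ℕ) → prodFactor p m ≡ go 1 m
    unfold m with 1
    ... | e = refl

coeffD : ℕ → ℕ → ℕ → ℕ
coeffD n r k = (n C k) * ((k + r) C k) * k !

module Modulo (p : ℕ) where

  -- A record rather than a definition, so that a and b can be inferred from a ≋ b.
  infix 4 _≋_
  record _≋_ (a b : ℤ) : Set where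
    constructor p∣difference
    field p∣a-b : + p ℤᵈ.∣ a - b
  open _≋_

  ≋-via : ∀ {a b c} → a - b ≡ c → + p ℤᵈ.∣ c → a ≋ b
  ≋-via a-b≡c p∣c = p∣difference (subst (+ p ℤᵈ.∣_) (sym a-b≡c) p∣c)

  ≋-isEquivalence : IsEquivalence _≋_
  ≋-isEquivalence = record
    { refl  = λ {a} → ≋-via (ℤ.+-inverseʳ a) (ℤᵈ.divides 0ℤ refl)
    ; sym   = λ {a} {b} a≋b →
        ≋-via (solve 2 (λ a b → b :- a := :- (a :- b)) refl a b) (ℤᵈ.∣m⇒∣-m (p∣a-b a≋b))
    ; trans = λ {a} {b} {c} a≋b b≋c →
        ≋-via (solve 3 (λ a b c → a :- c := (a :- b) :+ (b :- c)) refl a b c)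
              (ℤᵈ.∣m∣n⇒∣m+n (p∣a-b a≋b) (p∣a-b b≋c))
    }
    where
      open +-*-Solver

  open IsEquivalence ≋-isEquivalence public
    using () renaming (refl to ≋-refl; sym to ≋-sym; trans to ≋-trans; reflexive to ≡⇒≋)

  ≋-+-cong : Congruent₂ _≋_ ℤ._+_
  ≋-+-cong {a} {a′} {b} {b′} a≋a′ b≋b′ =
    ≋-via (solve 4 (λ a a′ b b′ → a :+ b :- (a′ :+ b′) := (a :- a′) :+ (b :- b′)) refl a a′ b b′)
          (ℤᵈ.∣m∣n⇒∣m+n (p∣a-b a≋a′) (p∣a-b b≋b′))
    where
      open +-*-Solver

  ≋-*-cong : Congruent₂ _≋_ ℤ._*_
  ≋-*-cong {a} {a′} {b} {b′} a≋a′ b≋b′ =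
    ≋-via (solve 4 (λ a a′ b b′ → a :* b :- a′ :* b′ := a :* (b :- b′) :+ (a :- a′) :* b′) refl a a′ b b′)
          (ℤᵈ.∣m∣n⇒∣m+n (ℤᵈ.∣n⇒∣m*n a (p∣a-b b≋b′)) (ℤᵈ.∣m⇒∣m*n b′ (p∣a-b a≋a′)))
    where
      open +-*-Solver

  ≋-^-cong : ∀ {a b} n → a ≋ b → a ^ n ≋ b ^ n
  ≋-^-cong zero    a≋b = ≋-refl
  ≋-^-cong (suc n) a≋b = ≋-*-cong a≋b (≋-^-cong n a≋b)

  p*≋0 : ∀ a → + p ℤ.* a ≋ 0ℤ
  p*≋0 a = ≋-via (ℤ.+-identityʳ _) (ℤᵈ.∣m⇒∣m*n a ℤᵈ.∣-refl)

  p∣⇒≋0 : ∀ {n} → p ∣ n → + n ≋ 0ℤ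
  p∣⇒≋0 {n} p∣n = ≋-via (ℤ.+-identityʳ (+ n)) (ℤᵈ.∣ᵤ⇒∣ p∣n)

  pos-*-cong : ∀ {a a′ b b′} → + a ≋ + a′ → + b ≋ + b′ → + (a * b) ≋ + (a′ * b′)
  pos-*-cong {a} {a′} {b} {b′} a≋a′ b≋b′ =
    subst₂ _≋_ (sym (ℤ.pos-* a b)) (sym (ℤ.pos-* a′ b′)) (≋-*-cong a≋a′ b≋b′)

  ≋⇒≡ℤ[mod] : ∀ {a b} → a ≋ b → a ≡ℤ b [mod p ]
  ≋⇒≡ℤ[mod] = ℤᵈ.∣⇒∣ᵤ ∘ p∣a-b

  ℤ/p : CommutativeSemiring 0ℓ 0ℓ
  ℤ/p = record
    { isCommutativeSemiring = isCommutativeSemiring-coarsen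
        ℤ.+-*-isCommutativeSemiring ≋-isEquivalence ≡⇒≋ ≋-+-cong ≋-*-cong
    }

  open Coefficientwise ≋-isEquivalence ≋-+-cong ≋-*-cong public

  ≗ₚ⇒≈ₚ : ∀ {P Q} → P ≗ₚ Q → P ≈ₚ Q
  ≗ₚ⇒≈ₚ P≗Q = ≈ₚ-reflexive (coeff-≡ P≗Q)

  ℤ/p[x] : CommutativeSemiring 0ℓ 0ℓ
  ℤ/p[x] = record
    { isCommutativeSemiring = isCommutativeSemiring-coarsen
        Poly-isCommutativeSemiring ≈ₚ-isEquivalence ≗ₚ⇒≈ₚ +ₚ-cong *ₚ-cong
    }

  ≈ₚ⇒≡ₚ[mod] : ∀ {P Q} → P ≈ₚ Q → P ≡ₚ Q [mod p ]
  ≈ₚ⇒≡ₚ[mod] {P} {Q} P≈Q i = ℤᵈ.∣⇒∣ᵤ (subst (+ p ℤᵈ.∣_) (sym (coeff-sub P Q i)) (p∣a-b (coeff-≈ P≈Q i)))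

  module ≋-Reasoning = SetoidReasoning (CommutativeSemiring.setoid ℤ/p)
  module ≈ₚ-Reasoning = SetoidReasoning (CommutativeSemiring.setoid ℤ/p[x])

  open import Algebra.Properties.Semiring.Mult (CommutativeSemiring.semiring ℤ/p) using () renaming (_×_ to _×ℤ_)
  open import Algebra.Properties.Semiring.Exp (CommutativeSemiring.semiring ℤ/p) using () renaming (_^_ to _^ℤ_)
  open import Algebra.Properties.Semiring.Mult (CommutativeSemiring.semiring ℤ/p[x]) using () renaming (_×_ to _×ₚ_)
  open import Algebra.Properties.Semiring.Exp (CommutativeSemiring.semiring ℤ/p[x]) as PolyExp
    using () renaming (_^_ to _^ᴾ_)

  ×ℤ-char : ∀ a → p ×ℤ a ≋ 0ℤ
  ×ℤ-char a = subst (_≋ 0ℤ) (sym (×ℤ≡* p)) (p*≋0 a)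
    where
      ×ℤ≡* : ∀ n → n ×ℤ a ≡ + n ℤ.* a
      ×ℤ≡* zero    = refl
      ×ℤ≡* (suc n) = trans (cong (λ t → a ℤ.+ t) (×ℤ≡* n)) (sym (ℤ.suc-* (+ n) a))

  ×ₚ-char : ∀ P → p ×ₚ P ≈ₚ []
  ×ₚ-char P = coeffwise λ i → subst (_≋ 0ℤ) (sym (coeff-× p i)) (p*≋0 (coeff P i))
    where
      coeff-× : ∀ n i → coeff (n ×ₚ P) i ≡ + n ℤ.* coeff P i
      coeff-× zero    i = refl
      coeff-× (suc n) i = trans (coeff-+ P (n ×ₚ P) i)
        (trans (cong (λ t → coeff P i ℤ.+ t) (coeff-× n i)) (sym (ℤ.suc-* (+ n) (coeff P i))))

  ^ℤ≡^ : ∀ a n → a ^ℤ n ≡ a ^ n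
  ^ℤ≡^ a zero    = refl
  ^ℤ≡^ a (suc n) = cong (a ℤ.*_) (^ℤ≡^ a n)

  ^ᴾ≡^ₚ : ∀ P n → P ^ᴾ n ≡ P ^ₚ n
  ^ᴾ≡^ₚ P zero    = refl
  ^ᴾ≡^ₚ P (suc n) = cong (P *ₚ_) (^ᴾ≡^ₚ P n)

  ^ₚ-cong : ∀ {P Q} n → P ≈ₚ Q → P ^ₚ n ≈ₚ Q ^ₚ n
  ^ₚ-cong {P} {Q} n P≈Q = subst₂ _≈ₚ_ (^ᴾ≡^ₚ P n) (^ᴾ≡^ₚ Q n) (PolyExp.^-congˡ n P≈Q)

  ^ₚ-+ : ∀ P m n → P ^ₚ (m + n) ≈ₚ P ^ₚ m *ₚ P ^ₚ n
  ^ₚ-+ P m n = subst₂ _≈ₚ_ (^ᴾ≡^ₚ P (m + n)) (cong₂ _*ₚ_ (^ᴾ≡^ₚ P m) (^ᴾ≡^ₚ P n)) (PolyExp.^-homo-* P m n)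

  ^ₚ-* : ∀ P m n → (P ^ₚ m) ^ₚ n ≈ₚ P ^ₚ (m * n)
  ^ₚ-* P m n = subst₂ _≈ₚ_ (trans (cong (_^ᴾ n) (^ᴾ≡^ₚ P m)) (^ᴾ≡^ₚ (P ^ₚ m) n)) (^ᴾ≡^ₚ P (m * n))
    (PolyExp.^-assocʳ P m n)

  module _ (p-prime : Prime p) where

    frobeniusℤ : ∀ a b → (a ℤ.+ b) ^ p ≋ a ^ p ℤ.+ b ^ p
    frobeniusℤ a b = subst₂ _≋_ (^ℤ≡^ (a ℤ.+ b) p) (cong₂ ℤ._+_ (^ℤ≡^ a p) (^ℤ≡^ b p))
      (Frobenius.frobenius ℤ/p p-prime ×ℤ-char a b)

    frobeniusₚ : ∀ P Q → (P +ₚ Q) ^ₚ p ≈ₚ P ^ₚ p +ₚ Q ^ₚ p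
    frobeniusₚ P Q = subst₂ _≈ₚ_ (^ᴾ≡^ₚ (P +ₚ Q) p) (cong₂ _+ₚ_ (^ᴾ≡^ₚ P p) (^ᴾ≡^ₚ Q p))
      (Frobenius.frobenius ℤ/p[x] p-prime ×ₚ-char P Q)

    fermatℕ : ∀ n → (+ n) ^ p ≋ + n
    fermatℕ zero    = ≡⇒≋ (subst (λ q → 0ℤ ^ q ≡ 0ℤ) (ℕ.suc-pred p {{prime⇒nonZero p-prime}}) refl)
    fermatℕ (suc n) = begin
      (+ suc n) ^ p           ≡⟨ cong (_^ p) +[1+n]≡+n+1 ⟩
      (+ n ℤ.+ 1ℤ) ^ p        ≈⟨ frobeniusℤ (+ n) 1ℤ ⟩
      (+ n) ^ p ℤ.+ 1ℤ ^ p    ≈⟨ ≋-+-cong (fermatℕ n) (≡⇒≋ (ℤ.^-zeroˡ p)) ⟩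
      + n ℤ.+ 1ℤ              ≡⟨ +[1+n]≡+n+1 ⟨
      + suc n                 ∎
      where
        open ≋-Reasoning
        +[1+n]≡+n+1 : + suc n ≡ + n ℤ.+ 1ℤ
        +[1+n]≡+n+1 = trans (cong +_ (ℕ.+-comm 1 n)) (ℤ.pos-+ n 1)

    fermat : ∀ a → a ^ p ≋ a
    fermat a = begin
      a ^ p       ≈⟨ ≋-^-cong p a≋r ⟩
      (+ r) ^ p   ≈⟨ fermatℕ r ⟩
      + r         ≈⟨ ≋-sym a≋r ⟩
      a           ∎
      where
        open ≋-Reasoning
        instance
          p≢0 : ℕ.NonZero p
          p≢0 = prime⇒nonZero p-prime
        r : ℕ
        r = a ℤ.%ℕ p
        a≋r : a ≋ + r
        a≋r = ≋-via (trans (cong (_- + r) (ℤ.a≡a%ℕn+[a/ℕn]*n a p))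
                           (solve 2 (λ r x → r :+ x :- r := x) refl (+ r) (a ℤ./ℕ p ℤ.* + p)))
                    (ℤᵈ.∣n⇒∣m*n (a ℤ./ℕ p) ℤᵈ.∣-refl)
          where
            open +-*-Solver

    fermat-* : ∀ a n → a ^ (p * n) ≋ a ^ n
    fermat-* a n = subst (_≋ a ^ n) (trans (ℤ.^-*-assoc a n p) (cong (a ^_) (ℕ.*-comm n p))) (fermat (a ^ n))

    fermat-digits : ∀ a {j} (m : Fin j → ℕ) → a ^ digitsVal p m ≋ a ^ digitSum m
    fermat-digits a {zero}  m = ≋-refl
    fermat-digits a {suc j} m = begin
      a ^ (head m + p * digitsVal p (tail m))          ≡⟨ ℤ.^-distribˡ-+-* a (head m) _ ⟩
      a ^ head m ℤ.* a ^ (p * digitsVal p (tail m))    ≈⟨ ≋-*-cong (≋-refl {a ^ head m}) (fermat-* a _) ⟩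
      a ^ head m ℤ.* a ^ digitsVal p (tail m)          ≈⟨ ≋-*-cong (≋-refl {a ^ head m}) (fermat-digits a (tail m)) ⟩
      a ^ head m ℤ.* a ^ digitSum (tail m)             ≡⟨ ℤ.^-distribˡ-+-* a (head m) _ ⟨
      a ^ digitSum m                                   ∎
      where
        open ≋-Reasoning

    xpow-1-^p : ∀ N → xpow-1 N ^ₚ p ≈ₚ xpow-1 (N * p)
    xpow-1-^p N = begin
      (monomial N +ₚ (-1ℤ ∷ [])) ^ₚ p         ≈⟨ frobeniusₚ (monomial N) (-1ℤ ∷ []) ⟩
      monomial N ^ₚ p +ₚ (-1ℤ ∷ []) ^ₚ p      ≈⟨ +ₚ-cong (≗ₚ⇒≈ₚ (monomial-^ N p)) (≗ₚ⇒≈ₚ (constant-^ -1ℤ p)) ⟩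
      monomial (N * p) +ₚ (-1ℤ ^ p ∷ [])      ≈⟨ +ₚ-cong ≈ₚ-refl (∷-cong (fermat -1ℤ) ≈ₚ-refl) ⟩
      monomial (N * p) +ₚ (-1ℤ ∷ [])          ∎
      where
        open ≈ₚ-Reasoning

    x-1-^p^ : ∀ e → x-1 ^ₚ (p ℕ.^ e) ≈ₚ xpow-1 (p ℕ.^ e)
    -- x-1 and xpow-1 1 are the same coefficient list.
    x-1-^p^ zero    = CommutativeSemiring.*-identityʳ ℤ/p[x] x-1
    x-1-^p^ (suc e) = begin
      x-1 ^ₚ (p * p ℕ.^ e)          ≡⟨ cong (x-1 ^ₚ_) (ℕ.*-comm p (p ℕ.^ e)) ⟩
      x-1 ^ₚ (p ℕ.^ e * p)          ≈⟨ ^ₚ-* x-1 (p ℕ.^ e) p ⟨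
      (x-1 ^ₚ (p ℕ.^ e)) ^ₚ p       ≈⟨ ^ₚ-cong p (x-1-^p^ e) ⟩
      xpow-1 (p ℕ.^ e) ^ₚ p         ≈⟨ xpow-1-^p (p ℕ.^ e) ⟩
      xpow-1 (p ℕ.^ e * p)          ≡⟨ cong xpow-1 (ℕ.*-comm (p ℕ.^ e) p) ⟩
      xpow-1 (p * p ℕ.^ e)          ∎
      where
        open ≈ₚ-Reasoning

    factorsFrom≈ : ∀ e {j} (m : Fin j → ℕ) → factorsFrom p e m ≈ₚ x-1 ^ₚ (p ℕ.^ e * digitsVal p m)
    factorsFrom≈ e {zero}  m = ≈ₚ-reflexive λ i → cong (λ n → coeff (x-1 ^ₚ n) i) (sym (ℕ.*-zeroʳ (p ℕ.^ e)))
    factorsFrom≈ e {suc j} m = begin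
      xpow-1 (p ℕ.^ e) ^ₚ head m *ₚ factorsFrom p (suc e) (tail m)
        ≈⟨ *ₚ-cong (^ₚ-cong (head m) (≈ₚ-sym (x-1-^p^ e))) (factorsFrom≈ (suc e) (tail m)) ⟩
      (x-1 ^ₚ (p ℕ.^ e)) ^ₚ head m *ₚ x-1 ^ₚ (p ℕ.^ suc e * V)
        ≈⟨ *ₚ-cong (^ₚ-* x-1 (p ℕ.^ e) (head m)) ≈ₚ-refl ⟩
      x-1 ^ₚ (p ℕ.^ e * head m) *ₚ x-1 ^ₚ (p ℕ.^ suc e * V)
        ≈⟨ ^ₚ-+ x-1 (p ℕ.^ e * head m) (p ℕ.^ suc e * V) ⟨
      x-1 ^ₚ (p ℕ.^ e * head m + p ℕ.^ suc e * V)
        ≡⟨ cong (x-1 ^ₚ_) (solve 4 (λ q a p v → q :* a :+ (p :* q) :* v := q :* (a :+ p :* v)) refl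
                             (p ℕ.^ e) (head m) p V) ⟩
      x-1 ^ₚ (p ℕ.^ e * digitsVal p m)
        ∎
      where
        open ≈ₚ-Reasoning
        open ℕ-Solver
        V : ℕ
        V = digitsVal p (tail m)

    prodFactor≈ : ∀ {j} (m : Fin j → ℕ) → prodFactor p m ≈ₚ x-1 ^ₚ (p * digitsVal p m)
    prodFactor≈ m = subst₂ _≈ₚ_ (sym (prodFactor≡factorsFrom p m))
      (cong (λ q → x-1 ^ₚ (q * digitsVal p m)) (ℕ.*-identityʳ p)) (factorsFrom≈ 1 m)

    C-+p : ∀ m {k} → k < p → + ((m + p) C k) ≋ + (m C k)
    C-+p zero    {zero}  _   = ≋-refl
    C-+p zero    {suc k} k<p = p∣⇒≋0 (prime∣C p-prime ℕ.z<s k<p)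
    C-+p (suc m) {zero}  _   = ≋-refl
    C-+p (suc m) {suc k} k<p = begin
      + (suc (m + p) C suc k)                   ≡⟨ pascal (m + p) ⟨
      + ((m + p) C k) ℤ.+ + ((m + p) C suc k)   ≈⟨ ≋-+-cong (C-+p m (ℕ.<-trans (ℕ.n<1+n k) k<p)) (C-+p m k<p) ⟩
      + (m C k) ℤ.+ + (m C suc k)               ≡⟨ pascal m ⟩
      + (suc m C suc k)                         ∎
      where
        open ≋-Reasoning
        pascal : ∀ n → + (n C k) ℤ.+ + (n C suc k) ≡ + (suc n C suc k)
        pascal n = trans (sym (ℤ.pos-+ (n C k) (n C suc k))) (cong +_ (nCk+nC[k+1]≡[n+1]C[k+1] n k))

    C-+p* : ∀ m N {k} → k < p → + ((m + p * N) C k) ≋ + (m C k)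
    C-+p* m zero    k<p rewrite ℕ.*-zeroʳ p | ℕ.+-identityʳ m = ≋-refl
    C-+p* m (suc N) {k} k<p = begin
      + ((m + p * suc N) C k)
        ≡⟨ cong (λ n → + (n C k)) (solve 3 (λ m p n → m :+ p :* (con 1 :+ n) := m :+ p :* n :+ p) refl m p N) ⟩
      + ((m + p * N + p) C k)
        ≈⟨ C-+p (m + p * N) k<p ⟩
      + ((m + p * N) C k)
        ≈⟨ C-+p* m N k<p ⟩
      + (m C k)
        ∎
      where
        open ≋-Reasoning
        open ℕ-Solver

    coeffD-+p* : ∀ m N r k → + coeffD (m + p * N) r k ≋ + coeffD m r k
    coeffD-+p* m N r k with k ℕ.<? p
    ... | yes k<p = pos-*-cong (pos-*-cong (C-+p* m N k<p) ≋-refl) ≋-refl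
    ... | no  k≮p = ≋-trans (p∣⇒≋0 (p∣coeffD (m + p * N))) (≋-sym (p∣⇒≋0 (p∣coeffD m)))
      where
        p∣coeffD : ∀ n → p ∣ coeffD n r k
        p∣coeffD n = ∣-trans (∣-trans (n∣n! p {{prime⇒nonZero p-prime}}) (m≤n⇒m!∣n! (ℕ.≮⇒≥ k≮p)))
                             (n∣m*n ((n C k) * ((k + r) C k)))

    D-+p* : ∀ r m N → D (m + p * N) r ≈ₚ x-1 ^ₚ (p * N) *ₚ D m r
    D-+p* r m N = begin
      D n r
        ≈⟨ Σ-cong (suc n) (λ k _ → ·ₚ-cong (coeffD-+p* m N r k) ≈ₚ-refl) ⟩
      Σ[< suc m + p * N ] (λ k → + coeffD m r k ·ₚ x-1 ^ₚ (n ℕ.∸ k))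
        ≈⟨ Σ-vanishing-tail (suc m) (p * N) vanish ⟩
      Σ[< suc m ] (λ k → + coeffD m r k ·ₚ x-1 ^ₚ (n ℕ.∸ k))
        ≈⟨ Σ-cong (suc m) split ⟩
      Σ[< suc m ] (λ k → + coeffD m r k ·ₚ x-1 ^ₚ (m ℕ.∸ k) *ₚ X)
        ≈⟨ ≗ₚ⇒≈ₚ (Σ-*ₚ-distribʳ (suc m) (λ k → + coeffD m r k ·ₚ x-1 ^ₚ (m ℕ.∸ k)) X) ⟩
      D m r *ₚ X
        ≈⟨ CommutativeSemiring.*-comm ℤ/p[x] (D m r) X ⟩
      X *ₚ D m r
        ∎
      where
        open ≈ₚ-Reasoning
        n : ℕ
        n = m + p * N
        X : Poly
        X = x-1 ^ₚ (p * N)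
        vanish : ∀ k → suc m ≤ k → + coeffD m r k ·ₚ x-1 ^ₚ (n ℕ.∸ k) ≈ₚ []
        vanish k m<k = ≈ₚ-trans
          (·ₚ-cong (≡⇒≋ (cong (λ c → + (c * ((k + r) C k) * k !)) (k>n⇒nCk≡0 m<k))) ≈ₚ-refl)
          (≗ₚ⇒≈ₚ (·ₚ-zeroˡ _))
        split : ∀ k → k < suc m → + coeffD m r k ·ₚ x-1 ^ₚ (n ℕ.∸ k) ≈ₚ + coeffD m r k ·ₚ x-1 ^ₚ (m ℕ.∸ k) *ₚ X
        split k k<1+m = begin
          c ·ₚ x-1 ^ₚ (m + p * N ℕ.∸ k)      ≡⟨ cong (λ e → c ·ₚ x-1 ^ₚ e) (ℕ.+-∸-comm (p * N) (ℕ.s≤s⁻¹ k<1+m)) ⟩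
          c ·ₚ x-1 ^ₚ (m ℕ.∸ k + p * N)      ≈⟨ ·ₚ-cong ≋-refl (^ₚ-+ x-1 (m ℕ.∸ k) (p * N)) ⟩
          c ·ₚ (x-1 ^ₚ (m ℕ.∸ k) *ₚ X)       ≈⟨ ≗ₚ⇒≈ₚ (·ₚ-*ₚ-assoc c (x-1 ^ₚ (m ℕ.∸ k)) X) ⟨
          c ·ₚ x-1 ^ₚ (m ℕ.∸ k) *ₚ X         ∎
          where
            c : ℤ
            c = + coeffD m r k

    D-p* : ∀ r N → D (p * N) r ≈ₚ x-1 ^ₚ (p * N)
    D-p* r N = ≈ₚ-trans (D-+p* r 0 N) (CommutativeSemiring.*-identityʳ ℤ/p[x] (x-1 ^ₚ (p * N)))

    D-digits : ∀ r m₀ {j} (m : Fin j → ℕ) → D (m₀ + p * digitsVal p m) r ≈ₚ prodFactor p m *ₚ D m₀ r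
    D-digits r m₀ m = ≈ₚ-trans (D-+p* r m₀ (digitsVal p m)) (*ₚ-cong (≈ₚ-sym (prodFactor≈ m)) ≈ₚ-refl)

    D-p*digits : ∀ r {j} (m : Fin j → ℕ) → D (p * digitsVal p m) r ≈ₚ prodFactor p m
    D-p*digits r m = ≈ₚ-trans (D-p* r (digitsVal p m)) (≈ₚ-sym (prodFactor≈ m))

    eval-D-p*digits : ∀ r {j} (m : Fin j → ℕ) k → eval (D (p * digitsVal p m) r) k ≋ (k - 1ℤ) ^ digitSum m
    eval-D-p*digits r m k = begin
      eval (D (p * V) r) k       ≈⟨ eval-cong k (D-p* r V) ⟩
      eval (x-1 ^ₚ (p * V)) k    ≡⟨ eval-x-1^ (p * V) k ⟩
      (k - 1ℤ) ^ (p * V)         ≈⟨ fermat-* (k - 1ℤ) V ⟩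
      (k - 1ℤ) ^ V               ≈⟨ fermat-digits (k - 1ℤ) m ⟩
      (k - 1ℤ) ^ digitSum m      ∎
      where
        open ≋-Reasoning
        V : ℕ
        V = digitsVal p m

corollary5 : (r : ℕ) → r ≥ 1 → (p : ℕ) → Prime p → p ≥ 3 → (s : ℕ) → s ≥ 1 →
    (m₀ : ℕ) → m₀ < p → (m : Fin s → ℕ) → (∀ i → m i < p) →
    (D (m₀ + p * digitsVal p m) r ≡ₚ prodFactor p m *ₚ D m₀ r [mod p ])
    × (D (p * digitsVal p m) r ≡ₚ prodFactor p m [mod p ])
    × (∀ (k : ℤ) → eval (D (p * digitsVal p m) r) k ≡ℤ (k - + 1) ^ digitSum m [mod p ])
corollary5 r _ p p-prime _ s _ m₀ _ m _ =
  ≈ₚ⇒≡ₚ[mod] (D-digits p-prime r m₀ m) ,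
  ≈ₚ⇒≡ₚ[mod] (D-p*digits p-prime r m) ,
  λ k → ≋⇒≡ℤ[mod] (eval-D-p*digits p-prime r m k)
  where
    open Modulo p
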